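{- Let $P$ be the infinite matrix indexed by the non-negative integers with $P(r+1,r)=1$, $P(r,r)=r-1$, $P(r,r+1)=-r-1$ for $r\geq0$, and $P(r,s)=0$ for $|r-s|>1$, and let $d_m=3\cdot2^m$. Let $m\geq4$. Partition the non-negative integers into the intervals $I_0=\{0,\dots,7\}$ and $I_k=\{8+d_{m-1}(k-1),\dots,7+d_{m-1}k\}$ for $k\geq1$. Then for $r\in I_a$, $s\in I_b$, the entry $E(r,s)$ of $E=P^{d_m}-I$ satisfies $\nu_2(E(r,s))\geq M(a,b)$, where: $M(0,0)=m-1$, $M(0,1)=m+3$, $M(0,2)=M(0,3)=m+7$, $M(0,b)=\infty$ for $b\geq4$; $M(1,0)=1$, $M(2,0)=M(3,0)=0$, $M(a,0)=\infty$ for $a\geq4$; and for $a,b\geq1$: $M(a,b)=1$ if $0\leq b-a\leq 3$, $M(a,b)=0$ if $1\leq a-b\leq3$, and $M(a,b)=\infty$ if $|a-b|\geq4$.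
   Context: $\nu_2$ denotes the $2$-adic valuation, with $\nu_2(0)=\infty$; a lower bound $\infty$ means the entry is $0$. $I$ is the identity matrix. -}

module Defs where

open import Data.Nat as ℕ using (ℕ; zero; suc; _≤_; _∸_; _^_)
open import Data.Integer as ℤ using (ℤ; +_; -[1+_]; _-_; _+_; _*_)
open import Data.Integer.Divisibility using (_∣_)
open import Relation.Nullary using (yes; no)
open import Relation.Binary.PropositionalEquality using (_≡_)

Mat : Set
Mat = ℕ → ℕ → ℤ

Id : Mat
Id r s with r ℕ.≟ s
... | yes _ = + 1
... | no  _ = + 0

P : Mat
P r s with s ℕ.≟ r
... | yes _ = + r - + 1
... | no _ with s ℕ.≟ suc r
...   | yes _ = -[1+ r ]
...   | no _ with r ℕ.≟ suc s
...     | yes _ = + 1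
...     | no _  = + 0

Σ< : ℕ → (ℕ → ℤ) → ℤ
Σ< zero    f = + 0
Σ< (suc n) f = Σ< n f + f n

-- Matrix product A · P.  The full sum Σ_k A(r,k) P(k,s) has only finitely many
-- nonzero terms, since P(k,s) = 0 for k ≥ s + 2; we sum over k < s + 2.
_·P : Mat → Mat
(A ·P) r s = Σ< (suc (suc s)) (λ k → A r k * P k s)

P^ : ℕ → Mat
P^ zero    = Id
P^ (suc n) = P^ n ·P

d : ℕ → ℕ
d m = 3 ℕ.* (2 ^ m)

E : ℕ → Mat
E m r s = P^ (d m) r s - Id r s

InI : ℕ → ℕ → ℕ → Set
InI m zero    r = r ≤ 7
InI m (suc k) r = (8 ℕ.+ d (m ∸ 1) ℕ.* k ≤ r) Data.Product.× (r ≤ 7 ℕ.+ d (m ∸ 1) ℕ.* suc k)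
  where import Data.Product

data ℕ∞ : Set where
  fin : ℕ → ℕ∞
  ∞   : ℕ∞

-- ν₂(x) ≥ M :  2^M ∣ x for finite M; x = 0 for M = ∞ (as ν₂(0) = ∞).
_≤ν₂_ : ℕ∞ → ℤ → Set
fin n ≤ν₂ x = (+ (2 ^ n)) ∣ x
∞     ≤ν₂ x = x ≡ + 0

M : ℕ → ℕ → ℕ → ℕ∞
M m zero zero = fin (m ∸ 1)
M m zero 1 = fin (m ℕ.+ 3)
M m zero 2 = fin (m ℕ.+ 7)
M m zero 3 = fin (m ℕ.+ 7)
M m zero (suc (suc (suc (suc _)))) = ∞
M m 1 zero = fin 1
M m 2 zero = fin 0
M m 3 zero = fin 0
M m (suc (suc (suc (suc _)))) zero = ∞
M m (suc a) (suc b) with a ℕ.≤? b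
... | yes _ with b ∸ a ℕ.≤? 3
...   | yes _ = fin 1
...   | no  _ = ∞
M m (suc a) (suc b) | no _ with a ∸ b ℕ.≤? 3
...   | yes _ = fin 0
...   | no  _ = ∞

-- Since d (m + 1) = 2 d m, we have E(m + 1) = E(m)² + 2 E(m), and every bound is proved by
-- induction on m through this formula, bounding each product E(m)(r,k) E(m)(k,s) of the sum
-- separately. Two facts about P^n supply the valuations: modulo 2 it is invariant under
-- (r, s) ↦ (r + 2, s + 2), which makes E(m) even wherever ⌊r/2⌋ < ⌊s/2⌋ + 2^m; and P^n(k, k + t)
-- is divisible by (k + 1)(k + 2)⋯(k + t), hence by 2^⌊t/2⌋. The bounds on the first eight rows
-- are computed exactly for m = 3 and then propagated by the squaring formula. Finally P^(d m) is
-- a band matrix of bandwidth d m, which gives the zero blocks.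

module Submission where

open import Defs
open import Data.Nat as ℕ using (ℕ; zero; suc; z≤n; s≤s; _≤_; _<_; _≟_; _<?_; _≤?_; _∸_; ⌊_/2⌋)
import Data.Nat.Properties as ℕP
open import Data.Nat.Properties using (allUpTo?)
import Data.Nat.Divisibility as ℕD
import Data.Nat.Tactic.RingSolver as NS
open import Data.Integer as ℤ using (ℤ; +_; -[1+_]; _-_; _+_; _*_; -_)
import Data.Integer.Properties as ℤP
open import Data.Integer.Divisibility.Signed
open import Data.Integer.Tactic.RingSolver using (solve-∀)
open import Data.List using (List; []; _∷_; length; applyUpTo)
open import Data.List.Properties using (length-applyUpTo)
open import Data.Empty using (⊥-elim)
open import Data.Product using (_,_)
open import Data.Sum using ([_,_]′)
open import Function using (_∘_)
open import Relation.Nullary using (Dec; yes; no; ¬_; contradiction)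
open import Relation.Nullary.Decidable using (map′; _→-dec_; from-yes)
open import Relation.Binary.PropositionalEquality

Σ<-cong : ∀ n {f g : ℕ → ℤ} → (∀ k → k < n → f k ≡ g k) → Σ< n f ≡ Σ< n g
Σ<-cong zero    f≗g = refl
Σ<-cong (suc n) f≗g = cong₂ _+_ (Σ<-cong n (λ k k<n → f≗g k (ℕP.m<n⇒m<1+n k<n))) (f≗g n ℕP.≤-refl)

Σ<-0 : ∀ n {f : ℕ → ℤ} → (∀ k → k < n → f k ≡ + 0) → Σ< n f ≡ + 0
Σ<-0 zero    f≗0 = refl
Σ<-0 (suc n) f≗0 = cong₂ _+_ (Σ<-0 n (λ k k<n → f≗0 k (ℕP.m<n⇒m<1+n k<n))) (f≗0 n ℕP.≤-refl)

Σ<-distrib-+ : ∀ n (f g : ℕ → ℤ) → Σ< n (λ k → f k + g k) ≡ Σ< n f + Σ< n g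
Σ<-distrib-+ zero    f g = refl
Σ<-distrib-+ (suc n) f g = trans (cong (_+ (f n + g n)) (Σ<-distrib-+ n f g))
                                 (interchange (Σ< n f) (Σ< n g) (f n) (g n))
  where
  interchange : ∀ a b c d → a + b + (c + d) ≡ a + c + (b + d)
  interchange = solve-∀

Σ<-*-distribˡ : ∀ n c (f : ℕ → ℤ) → Σ< n (λ k → c * f k) ≡ c * Σ< n f
Σ<-*-distribˡ zero    c f = sym (ℤP.*-zeroʳ c)
Σ<-*-distribˡ (suc n) c f = trans (cong (_+ c * f n) (Σ<-*-distribˡ n c f))
                                  (sym (ℤP.*-distribˡ-+ c (Σ< n f) (f n)))

Σ<-*-distribʳ : ∀ n c (f : ℕ → ℤ) → Σ< n (λ k → f k * c) ≡ Σ< n f * c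
Σ<-*-distribʳ zero    c f = refl
Σ<-*-distribʳ (suc n) c f = trans (cong (_+ f n * c) (Σ<-*-distribʳ n c f))
                                  (sym (ℤP.*-distribʳ-+ c (Σ< n f) (f n)))

Σ<-comm : ∀ n m (h : ℕ → ℕ → ℤ) →
          Σ< n (λ j → Σ< m (h j)) ≡ Σ< m (λ k → Σ< n (λ j → h j k))
Σ<-comm zero    m h = sym (Σ<-0 m (λ _ _ → refl))
Σ<-comm (suc n) m h = trans (cong (_+ Σ< m (h n)) (Σ<-comm n m h))
                            (sym (Σ<-distrib-+ m (λ k → Σ< n (λ j → h j k)) (h n)))

Σ<-single : ∀ n i {f : ℕ → ℤ} → i < n → (∀ k → k < n → k ≢ i → f k ≡ + 0) → Σ< n f ≡ f i
Σ<-single (suc n) i {f} i<1+n f≗0 with i ≟ n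
... | yes refl = trans (cong (_+ f i) (Σ<-0 n (λ k k<n → f≗0 k (ℕP.m<n⇒m<1+n k<n) (ℕP.<⇒≢ k<n))))
                       (ℤP.+-identityˡ (f i))
... | no i≢n   = trans (cong₂ _+_ (Σ<-single n i (ℕP.≤∧≢⇒< (ℕP.≤-pred i<1+n) i≢n)
                                                 (λ k k<n → f≗0 k (ℕP.m<n⇒m<1+n k<n)))
                                  (f≗0 n ℕP.≤-refl (≢-sym i≢n)))
                       (ℤP.+-identityʳ (f i))

Id-diag : ∀ r → Id r r ≡ + 1
Id-diag r with r ≟ r
... | yes _  = refl
... | no r≢r = ⊥-elim (r≢r refl)

Id-off : ∀ {r s} → r ≢ s → Id r s ≡ + 0
Id-off {r} {s} r≢s with r ≟ s
... | yes r≡s = ⊥-elim (r≢s r≡s)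
... | no _    = refl

P-diag : ∀ s → P s s ≡ + s - + 1
P-diag s with s ≟ s
... | yes _  = refl
... | no s≢s = ⊥-elim (s≢s refl)

P-super : ∀ s → P s (suc s) ≡ -[1+ s ]
P-super s with suc s ≟ s
... | yes 1+s≡s = ⊥-elim (ℕP.1+n≢n 1+s≡s)
... | no _ with suc s ≟ suc s
...   | yes _      = refl
...   | no 1+s≢1+s = ⊥-elim (1+s≢1+s refl)

P-sub : ∀ s → P (suc s) s ≡ + 1
P-sub s with s ≟ suc s
... | yes s≡1+s = ⊥-elim (ℕP.1+n≢n (sym s≡1+s))
... | no _ with s ≟ suc (suc s)
...   | yes s≡2+s = ⊥-elim (ℕP.<⇒≢ (ℕP.m<n⇒m<1+n (ℕP.n<1+n s)) s≡2+s)
...   | no _ with suc s ≟ suc s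
...     | yes _      = refl
...     | no 1+s≢1+s = ⊥-elim (1+s≢1+s refl)

P-above : ∀ {k s} → suc (suc k) ≤ s → P k s ≡ + 0
P-above {k} {s} 2+k≤s with s ≟ k
... | yes refl = ⊥-elim (ℕP.<-irrefl refl (ℕP.<-trans (ℕP.n<1+n s) 2+k≤s))
... | no _ with s ≟ suc k
...   | yes refl = ⊥-elim (ℕP.<-irrefl refl 2+k≤s)
...   | no _ with k ≟ suc s
...     | yes refl = ⊥-elim (ℕP.<-asym (ℕP.<-trans (ℕP.n<1+n s) (ℕP.n<1+n (suc s))) 2+k≤s)
...     | no _     = refl

-- The diagonal coefficient + suc s - + 1 of P is written + s, to which it reduces.
row·P : (ℕ → ℤ) → ℕ → ℤ
row·P v zero    = v 0 * -[1+ 0 ] + v 1 * + 1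
row·P v (suc s) = v s * -[1+ s ] + v (suc s) * + s + v (suc (suc s)) * + 1

·P≡row·P : ∀ A r s → (A ·P) r s ≡ row·P (A r) s
·P≡row·P A r zero = begin
  + 0 + A r 0 * P 0 0 + A r 1 * P 1 0    ≡⟨ cong₂ (λ p q → + 0 + A r 0 * p + A r 1 * q) (P-diag 0) (P-sub 0) ⟩
  + 0 + A r 0 * -[1+ 0 ] + A r 1 * + 1   ≡⟨ cong (_+ A r 1 * + 1) (ℤP.+-identityˡ (A r 0 * -[1+ 0 ])) ⟩
  row·P (A r) 0                          ∎
  where open ≡-Reasoning
·P≡row·P A r (suc s) = begin
  Σ< s f + f s + f (suc s) + f (suc (suc s))
    ≡⟨ cong (λ z → z + f s + f (suc s) + f (suc (suc s))) (Σ<-0 s far) ⟩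
  + 0 + f s + f (suc s) + f (suc (suc s))
    ≡⟨ cong (λ z → z + f (suc s) + f (suc (suc s))) (ℤP.+-identityˡ (f s)) ⟩
  f s + f (suc s) + f (suc (suc s))
    ≡⟨ cong₂ (λ p q → A r s * p + A r (suc s) * q + f (suc (suc s))) (P-super s) (P-diag (suc s)) ⟩
  A r s * -[1+ s ] + A r (suc s) * + s + A r (suc (suc s)) * P (suc (suc s)) (suc s)
    ≡⟨ cong (λ o → A r s * -[1+ s ] + A r (suc s) * + s + A r (suc (suc s)) * o) (P-sub (suc s)) ⟩
  row·P (A r) (suc s) ∎
  where
  open ≡-Reasoning
  f : ℕ → ℤ
  f k = A r k * P k (suc s)
  far : ∀ k → k < s → f k ≡ + 0
  far k k<s = trans (cong (A r k *_) (P-above (s≤s k<s))) (ℤP.*-zeroʳ (A r k))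

P^-suc : ∀ n r s → P^ (suc n) r s ≡ row·P (P^ n r) s
P^-suc n = ·P≡row·P (P^ n)

row·P-cong : ∀ {v w} → (∀ i → v i ≡ w i) → ∀ s → row·P v s ≡ row·P w s
row·P-cong v≗w zero    rewrite v≗w 0 | v≗w 1 = refl
row·P-cong v≗w (suc s) rewrite v≗w s | v≗w (suc s) | v≗w (suc (suc s)) = refl

row·P-vanish : ∀ v s → v s ≡ + 0 → v (suc s) ≡ + 0 → v (suc (suc s)) ≡ + 0 → row·P v (suc s) ≡ + 0
row·P-vanish v s v₀ v₁ v₂ rewrite v₀ | v₁ | v₂ = refl

P^-above : ∀ n {r s} → r ℕ.+ n < s → P^ n r s ≡ + 0
P^-above zero {r} r+0<s = Id-off (λ r≡s → ℕP.<⇒≢ r+0<s (trans (ℕP.+-identityʳ r) r≡s))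
P^-above (suc n) {r} {suc s} r+1+n<1+s = trans (P^-suc n r (suc s))
  (row·P-vanish (P^ n r) s (P^-above n r+n<s)
                           (P^-above n (ℕP.m<n⇒m<1+n r+n<s))
                           (P^-above n (ℕP.m<n⇒m<1+n (ℕP.m<n⇒m<1+n r+n<s))))
  where
  r+n<s : r ℕ.+ n < s
  r+n<s = ℕP.≤-pred (subst (_< suc s) (ℕP.+-suc r n) r+1+n<1+s)

P^-below : ∀ n {r s} → s ℕ.+ n < r → P^ n r s ≡ + 0
P^-below zero {r} {s} s+0<r = Id-off (λ r≡s → ℕP.<⇒≢ s+0<r (trans (ℕP.+-identityʳ s) (sym r≡s)))
P^-below (suc n) {r} {zero} 1+n<r
  rewrite P^-suc n r 0
        | P^-below n {r} {0} (ℕP.<-trans (ℕP.n<1+n n) 1+n<r)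
        | P^-below n {r} {1} 1+n<r = refl
P^-below (suc n) {r} {suc s} s+1+n<r = trans (P^-suc n r (suc s))
  (row·P-vanish (P^ n r) s
     (P^-below n (ℕP.≤-<-trans (ℕP.+-mono-≤ (ℕP.n≤1+n s) (ℕP.n≤1+n n)) s+1+n<r))
     (P^-below n (ℕP.≤-<-trans (ℕP.+-monoʳ-≤ (suc s) (ℕP.n≤1+n n)) s+1+n<r))
     (P^-below n (subst (_< r) (ℕP.+-suc (suc s) n) s+1+n<r)))

Σ<-Id* : ∀ K r (f : ℕ → ℤ) → r < K → Σ< K (λ k → Id r k * f k) ≡ f r
Σ<-Id* K r f r<K =
  trans (Σ<-single K r r<K (λ k _ k≢r → cong (_* f k) (Id-off (≢-sym k≢r))))
        (trans (cong (_* f r) (Id-diag r)) (ℤP.*-identityˡ (f r)))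

Σ<-*Id : ∀ K s (g : ℕ → ℤ) → (K ≤ s → g s ≡ + 0) → Σ< K (λ k → g k * Id k s) ≡ g s
Σ<-*Id K s g g≗0 with s <? K
... | yes s<K = trans (Σ<-single K s s<K (λ k _ k≢s → trans (cong (g k *_) (Id-off k≢s)) (ℤP.*-zeroʳ (g k))))
                      (trans (cong (g s *_) (Id-diag s)) (ℤP.*-identityʳ (g s)))
... | no s≮K  = trans (Σ<-0 K (λ k k<K → trans (cong (g k *_) (Id-off (λ { refl → s≮K k<K }))) (ℤP.*-zeroʳ (g k))))
                      (sym (g≗0 (ℕP.≮⇒≥ s≮K)))

P^-+ : ∀ N n r s → P^ (N ℕ.+ n) r s ≡ Σ< (suc (r ℕ.+ N)) (λ k → P^ N r k * P^ n k s)
P^-+ N zero r s rewrite ℕP.+-identityʳ N =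
  sym (Σ<-*Id (suc (r ℕ.+ N)) s (P^ N r) (λ 1+r+N≤s → P^-above N 1+r+N≤s))
P^-+ N (suc n) r s rewrite ℕP.+-suc N n = begin
  Σ< (suc (suc s)) (λ j → P^ (N ℕ.+ n) r j * P j s)
    ≡⟨ Σ<-cong (suc (suc s)) (λ j _ → cong (_* P j s) (P^-+ N n r j)) ⟩
  Σ< (suc (suc s)) (λ j → Σ< K (λ k → P^ N r k * P^ n k j) * P j s)
    ≡⟨ Σ<-cong (suc (suc s)) (λ j _ → sym (Σ<-*-distribʳ K (P j s) (λ k → P^ N r k * P^ n k j))) ⟩
  Σ< (suc (suc s)) (λ j → Σ< K (λ k → P^ N r k * P^ n k j * P j s))
    ≡⟨ Σ<-comm (suc (suc s)) K _ ⟩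
  Σ< K (λ k → Σ< (suc (suc s)) (λ j → P^ N r k * P^ n k j * P j s))
    ≡⟨ Σ<-cong K (λ k _ → trans (Σ<-cong (suc (suc s)) (λ j _ → ℤP.*-assoc (P^ N r k) (P^ n k j) (P j s)))
                                 (Σ<-*-distribˡ (suc (suc s)) (P^ N r k) (λ j → P^ n k j * P j s))) ⟩
  Σ< K (λ k → P^ N r k * P^ (suc n) k s) ∎
  where
  open ≡-Reasoning
  K = suc (r ℕ.+ N)

d-suc : ∀ m → d (suc m) ≡ d m ℕ.+ d m
d-suc m = distrib (2 ℕ.^ m)
  where
  distrib : ∀ x → 3 ℕ.* (2 ℕ.* x) ≡ 3 ℕ.* x ℕ.+ 3 ℕ.* x
  distrib = NS.solve-∀

E-above : ∀ m r s → r ℕ.+ d m < s → E m r s ≡ + 0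
E-above m r s r+d<s = cong₂ _-_ (P^-above (d m) r+d<s)
  (Id-off (λ r≡s → ℕP.<⇒≢ (ℕP.≤-<-trans (ℕP.m≤m+n r (d m)) r+d<s) r≡s))

E-below : ∀ m r s → s ℕ.+ d m < r → E m r s ≡ + 0
E-below m r s s+d<r = cong₂ _-_ (P^-below (d m) s+d<r)
  (Id-off (λ r≡s → ℕP.<⇒≢ (ℕP.≤-<-trans (ℕP.m≤m+n s (d m)) s+d<r) (sym r≡s)))

E-suc : ∀ m r s → E (suc m) r s ≡ Σ< (suc (r ℕ.+ d m)) (λ k → E m r k * E m k s) + (E m r s + E m r s)
E-suc m r s = begin
  P^ (d (suc m)) r s - Id r s
    ≡⟨ cong (λ n → P^ n r s - Id r s) (d-suc m) ⟩
  P^ (N ℕ.+ N) r s - Id r s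
    ≡⟨ cong (_- Id r s) (P^-+ N N r s) ⟩
  Σ< K (λ k → Q r k * Q k s) - Id r s
    ≡⟨ cong (_- Id r s) (Σ<-cong K (λ k _ → trans (cong (_* Q k s) (split (Q r k) (Id r k)))
                                                   (ℤP.*-distribʳ-+ (Q k s) (E m r k) (Id r k)))) ⟩
  Σ< K (λ k → E m r k * Q k s + Id r k * Q k s) - Id r s
    ≡⟨ cong (_- Id r s) (Σ<-distrib-+ K (λ k → E m r k * Q k s) (λ k → Id r k * Q k s)) ⟩
  Σ< K (λ k → E m r k * Q k s) + Σ< K (λ k → Id r k * Q k s) - Id r s
    ≡⟨ cong (λ z → Σ< K (λ k → E m r k * Q k s) + z - Id r s) (Σ<-Id* K r (λ k → Q k s) (ℕP.m≤m+n (suc r) N)) ⟩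
  Σ< K (λ k → E m r k * Q k s) + Q r s - Id r s
    ≡⟨ cong (λ z → z + Q r s - Id r s) (Σ<-cong K (λ k _ → trans (cong (E m r k *_) (split (Q k s) (Id k s)))
                                                                 (ℤP.*-distribˡ-+ (E m r k) (E m k s) (Id k s)))) ⟩
  Σ< K (λ k → E m r k * E m k s + E m r k * Id k s) + Q r s - Id r s
    ≡⟨ cong (λ z → z + Q r s - Id r s) (Σ<-distrib-+ K (λ k → E m r k * E m k s) (λ k → E m r k * Id k s)) ⟩
  Σ< K (λ k → E m r k * E m k s) + Σ< K (λ k → E m r k * Id k s) + Q r s - Id r s
    ≡⟨ cong (λ z → Σ< K (λ k → E m r k * E m k s) + z + Q r s - Id r s) (Σ<-*Id K s (E m r) (E-above m r s)) ⟩
  Σ< K (λ k → E m r k * E m k s) + E m r s + Q r s - Id r s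
    ≡⟨ regroup (Σ< K (λ k → E m r k * E m k s)) (Q r s) (Id r s) ⟩
  Σ< K (λ k → E m r k * E m k s) + (E m r s + E m r s) ∎
  where
  open ≡-Reasoning
  N = d m
  K = suc (r ℕ.+ N)
  Q = P^ N
  split : ∀ a b → a ≡ (a - b) + b
  split = solve-∀
  regroup : ∀ x a b → x + (a - b) + a - b ≡ x + ((a - b) + (a - b))
  regroup = solve-∀

E-off : ∀ m r s → r ≢ s → E m r s ≡ P^ (d m) r s
E-off m r s r≢s = trans (cong (λ i → P^ (d m) r s - i) (Id-off r≢s)) (ℤP.+-identityʳ (P^ (d m) r s))

∣0 : ∀ a → a ∣ + 0
∣0 a = divides (+ 0) refl

1∣ : ∀ x → + 1 ∣ x
1∣ x = divides x (sym (ℤP.*-identityʳ x))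

∣-Σ< : ∀ n {a} {f : ℕ → ℤ} → (∀ k → k < n → a ∣ f k) → a ∣ Σ< n f
∣-Σ< zero    {a} a∣f = ∣0 a
∣-Σ< (suc n)     a∣f = ∣m∣n⇒∣m+n (∣-Σ< n (λ k k<n → a∣f k (ℕP.m<n⇒m<1+n k<n))) (a∣f n ℕP.≤-refl)

*-pres-∣ : ∀ {a b x y} → a ∣ x → b ∣ y → a * b ∣ x * y
*-pres-∣ {a} {b} (divides p refl) (divides q refl) = divides (p * q) (interchange p a q b)
  where
  interchange : ∀ p a q b → p * a * (q * b) ≡ p * q * (a * b)
  interchange = solve-∀

infix 4 2^_∣_

-- A record rather than a definition, so that the exponent can be inferred.
record 2^_∣_ (k : ℕ) (x : ℤ) : Set where
  constructor 2^∣
  field divisibility : + (2 ℕ.^ k) ∣ x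

open 2^_∣_

∣⇒≤ν₂ : ∀ {k x} → 2^ k ∣ x → fin k ≤ν₂ x
∣⇒≤ν₂ (2^∣ 2^k∣x) = ∣⇒∣ᵤ 2^k∣x

2^∣0 : ∀ {k} → 2^ k ∣ + 0
2^∣0 = 2^∣ (∣0 _)

2^∣-≡0 : ∀ {k x} → x ≡ + 0 → 2^ k ∣ x
2^∣-≡0 refl = 2^∣0

2^0∣ : ∀ x → 2^ 0 ∣ x
2^0∣ x = 2^∣ (1∣ x)

2^∣-+ : ∀ {k x y} → 2^ k ∣ x → 2^ k ∣ y → 2^ k ∣ x + y
2^∣-+ (2^∣ p) (2^∣ q) = 2^∣ (∣m∣n⇒∣m+n p q)

2^∣-*ˡ : ∀ {k} x {y} → 2^ k ∣ y → 2^ k ∣ x * y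
2^∣-*ˡ x (2^∣ p) = 2^∣ (∣n⇒∣m*n x p)

2^∣-*ʳ : ∀ {k x} y → 2^ k ∣ x → 2^ k ∣ x * y
2^∣-*ʳ y (2^∣ p) = 2^∣ (∣m⇒∣m*n y p)

2^∣-Σ< : ∀ n {k} {f : ℕ → ℤ} → (∀ i → i < n → 2^ k ∣ f i) → 2^ k ∣ Σ< n f
2^∣-Σ< n 2^k∣f = 2^∣ (∣-Σ< n (λ i i<n → divisibility (2^k∣f i i<n)))

2^∣-* : ∀ {a b x y} → 2^ a ∣ x → 2^ b ∣ y → 2^ (a ℕ.+ b) ∣ x * y
2^∣-* {a} {b} (2^∣ p) (2^∣ q) = 2^∣
  (subst (_∣ _) (sym (trans (cong +_ (ℕP.^-distribˡ-+-* 2 a b)) (ℤP.pos-* (2 ℕ.^ a) (2 ℕ.^ b))))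
         (*-pres-∣ p q))

2^∣-weaken : ∀ {a b x} → a ≤ b → 2^ b ∣ x → 2^ a ∣ x
2^∣-weaken {a} a≤b (2^∣ 2^b∣x) with ℕP.m≤n⇒∃[o]m+o≡n a≤b
... | c , refl = 2^∣ (∣-trans 2^a∣2^[a+c] 2^b∣x)
  where
  2^a∣2^[a+c] : + (2 ℕ.^ a) ∣ + (2 ℕ.^ (a ℕ.+ c))
  2^a∣2^[a+c] = divides (+ (2 ℕ.^ c)) (trans
    (cong +_ (trans (ℕP.^-distribˡ-+-* 2 a c) (ℕP.*-comm (2 ℕ.^ a) (2 ℕ.^ c))))
    (ℤP.pos-* (2 ℕ.^ c) (2 ℕ.^ a)))

2∣2* : ∀ x → 2^ 1 ∣ + 2 * x
2∣2* x = 2^∣-*ʳ x (2^∣ (divides (+ 1) refl))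

2^∣-double : ∀ {a x} → 2^ a ∣ x → 2^ (suc a) ∣ x + x
2^∣-double {a} {x} 2^a∣x = subst (2^ suc a ∣_) (twice x) (2^∣-* (2∣2* (+ 1)) 2^a∣x)
  where
  twice : ∀ x → + 2 * x ≡ x + x
  twice = solve-∀

2^?_∣_ : ∀ k x → Dec (2^ k ∣ x)
2^? k ∣ x = map′ 2^∣ divisibility (+ (2 ℕ.^ k) ∣? x)

E-suc-∣ : ∀ m {e r s} → (∀ k → 2^ e ∣ E m r k * E m k s) → 2^ e ∣ E m r s + E m r s → 2^ e ∣ E (suc m) r s
E-suc-∣ m {e} {r} {s} 2^e∣terms 2^e∣2E =
  subst (2^ e ∣_) (sym (E-suc m r s)) (2^∣-+ (2^∣-Σ< (suc (r ℕ.+ d m)) (λ k _ → 2^e∣terms k)) 2^e∣2E)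

-- Rising products

rising : ℕ → ℕ → ℕ
rising k zero    = 1
rising k (suc t) = rising k t ℕ.* suc (t ℕ.+ k)

rising∣P^ : ∀ n k t → + rising k t ∣ P^ n k (t ℕ.+ k)
rising∣P^ n       k zero    = 1∣ (P^ n k k)
rising∣P^ zero    k (suc t) = subst (+ rising k (suc t) ∣_) (sym (Id-off (ℕP.m≢1+n+m k))) (∣0 _)
rising∣P^ (suc n) k (suc t) =
  subst (+ rising k (suc t) ∣_) (sym (P^-suc n k (suc j))) (∣m∣n⇒∣m+n (∣m∣n⇒∣m+n left middle) right)
  where
  j = t ℕ.+ k
  left : + rising k (suc t) ∣ P^ n k j * -[1+ j ]
  left = subst (_∣ P^ n k j * -[1+ j ]) (sym (ℤP.pos-* (rising k t) (suc j)))
               (*-pres-∣ (rising∣P^ n k t) (divides ℤ.-1ℤ (sym (ℤP.-1*i≡-i (+ suc j)))))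
  middle : + rising k (suc t) ∣ P^ n k (suc j) * + j
  middle = ∣m⇒∣m*n _ (rising∣P^ n k (suc t))
  right : + rising k (suc t) ∣ P^ n k (suc (suc j)) * + 1
  right = ∣m⇒∣m*n _ (∣-trans (divides (+ suc (suc j)) (trans (cong +_ (ℕP.*-comm (rising k (suc t)) (suc (suc j))))
                                                           (ℤP.pos-* (suc (suc j)) (rising k (suc t)))))
                             (rising∣P^ n k (suc (suc t))))

2∣n*[1+n] : ∀ n → 2 ℕD.∣ n ℕ.* suc n
2∣n*[1+n] zero    = ℕD.divides 0 refl
2∣n*[1+n] (suc n) = subst (2 ℕD.∣_) (sym (expand n)) (ℕD.∣m∣n⇒∣m+n (2∣n*[1+n] n) (ℕD.∣m⇒∣m*n (suc n) ℕD.∣-refl))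
  where
  expand : ∀ n → suc n ℕ.* suc (suc n) ≡ n ℕ.* suc n ℕ.+ 2 ℕ.* suc n
  expand = NS.solve-∀

2^⌊t/2⌋∣rising : ∀ k t → 2 ℕ.^ ⌊ t /2⌋ ℕD.∣ rising k t
2^⌊t/2⌋∣rising k zero          = ℕD.∣-refl
2^⌊t/2⌋∣rising k (suc zero)    = ℕD.1∣ _
2^⌊t/2⌋∣rising k (suc (suc t)) =
  subst₂ ℕD._∣_ (ℕP.*-comm (2 ℕ.^ ⌊ t /2⌋) 2) (sym (ℕP.*-assoc (rising k t) a (suc a)))
         (ℕD.*-pres-∣ (2^⌊t/2⌋∣rising k t) (2∣n*[1+n] a))
  where
  a = suc (t ℕ.+ k)

2^⌊t/2⌋∣E : ∀ m k t → 2^ ⌊ suc t /2⌋ ∣ E m k (suc t ℕ.+ k)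
2^⌊t/2⌋∣E m k t = subst (2^ _ ∣_) (sym (E-off m k (suc t ℕ.+ k) (ℕP.m≢1+n+m k)))
  (2^∣ (∣-trans (∣ᵤ⇒∣ (2^⌊t/2⌋∣rising k (suc t))) (rising∣P^ (d m) k (suc t))))

2^5∣E-far : ∀ m k s → k ℕ.+ 10 ≤ s → 2^ 5 ∣ E m k s
2^5∣E-far m k s k+10≤s with ℕP.m≤n⇒∃[o]m+o≡n k+10≤s
... | u , refl = subst (λ s → 2^ 5 ∣ E m k s) (shuffle k u)
                       (2^∣-weaken (ℕP.m≤m+n 5 ⌊ u /2⌋) (2^⌊t/2⌋∣E m k (9 ℕ.+ u)))
  where
  shuffle : ∀ k u → 10 ℕ.+ u ℕ.+ k ≡ k ℕ.+ 10 ℕ.+ u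
  shuffle = NS.solve-∀

-- Parity

Id-suc : ∀ r s → Id (suc r) (suc s) ≡ Id r s
Id-suc r s with r ≟ s
... | yes refl = Id-diag (suc r)
... | no r≢s   = Id-off (r≢s ∘ ℕP.suc-injective)

row·P-shift : ∀ v w → (∀ i → 2^ 1 ∣ v (2 ℕ.+ i) - w i) → ∀ s → 2^ 1 ∣ row·P v (2 ℕ.+ s) - row·P w s
row·P-shift v w 2∣v-w zero = subst (2^ 1 ∣_) (sym (regroup (v 1) (v 2) (v 3) (w 0) (w 1)))
  (2^∣-+ (2^∣-+ (2∣v-w 0) (2∣v-w 1)) (2∣2* _))
  where
  regroup : ∀ v₁ v₂ v₃ w₀ w₁ → v₁ * - + 2 + v₂ * + 1 + v₃ * + 1 - (w₀ * - + 1 + w₁ * + 1)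
                              ≡ (v₂ - w₀) + (v₃ - w₁) + + 2 * (w₀ - v₁)
  regroup = solve-∀
row·P-shift v w 2∣v-w (suc s) = subst (2^ 1 ∣_) (sym (regroup (v (2 ℕ.+ s)) (v (3 ℕ.+ s)) (v (4 ℕ.+ s)) (w s) (w (1 ℕ.+ s)) (w (2 ℕ.+ s)) (+ s)))
  (2^∣-+ (2^∣-+ (2^∣-+ (2^∣-*ʳ _ (2∣v-w s)) (2^∣-*ʳ _ (2∣v-w (1 ℕ.+ s)))) (2∣v-w (2 ℕ.+ s)))
         (2∣2* _))
  where
  regroup : ∀ v₀ v₁ v₂ w₀ w₁ w₂ x →
    v₀ * - (+ 3 + x) + v₁ * (+ 2 + x) + v₂ * + 1 - (w₀ * - (+ 1 + x) + w₁ * x + w₂ * + 1)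
      ≡ (v₀ - w₀) * - (+ 1 + x) + (v₁ - w₁) * x + (v₂ - w₂) + + 2 * (v₁ - v₀)
  regroup = solve-∀

P^-shift : ∀ n r s → 2^ 1 ∣ P^ n (2 ℕ.+ r) (2 ℕ.+ s) - P^ n r s
P^-shift zero r s = subst (2^ 1 ∣_) (sym (trans (cong (_- Id r s) (trans (Id-suc (suc r) (suc s)) (Id-suc r s)))
                                                (ℤP.+-inverseʳ (Id r s))))
                          2^∣0
P^-shift (suc n) r s = subst (2^ 1 ∣_) (sym (cong₂ _-_ (P^-suc n (2 ℕ.+ r) (2 ℕ.+ s)) (P^-suc n r s)))
                             (row·P-shift (P^ n (2 ℕ.+ r)) (P^ n r) (P^-shift n r) s)

E-shift : ∀ m r s → 2^ 1 ∣ E m r s → 2^ 1 ∣ E m (2 ℕ.+ r) (2 ℕ.+ s)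
E-shift m r s 2∣E = subst (2^ 1 ∣_) (sym (begin
    Q (2 ℕ.+ r) (2 ℕ.+ s) - Id (2 ℕ.+ r) (2 ℕ.+ s)  ≡⟨ cong (λ i → Q (2 ℕ.+ r) (2 ℕ.+ s) - i) (trans (Id-suc (suc r) (suc s)) (Id-suc r s)) ⟩
    Q (2 ℕ.+ r) (2 ℕ.+ s) - Id r s                  ≡⟨ telescope (Q (2 ℕ.+ r) (2 ℕ.+ s)) (Q r s) (Id r s) ⟩
    (Q (2 ℕ.+ r) (2 ℕ.+ s) - Q r s) + E m r s       ∎))
  (2^∣-+ (P^-shift (d m) r s) 2∣E)
  where
  open ≡-Reasoning
  Q = P^ (d m)
  telescope : ∀ a b c → a - c ≡ (a - b) + (b - c)
  telescope = solve-∀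

E₀-even-r<2 : ∀ r s → r < 2 → 2^ 1 ∣ E 0 r s
E₀-even-r<2 r s r<2 with s <? 5
... | yes s<5 = from-yes (allUpTo? (λ r → allUpTo? (λ s → 2^? 1 ∣ E 0 r s) 5) 2) r<2 s<5
... | no s≮5  = 2^∣-≡0 (E-above 0 r s (ℕP.≤-<-trans (ℕP.+-monoˡ-≤ 3 (ℕP.≤-pred r<2)) (ℕP.≮⇒≥ s≮5)))

E₀-even : ∀ r s → ⌊ r /2⌋ < ⌊ s /2⌋ ℕ.+ 1 → 2^ 1 ∣ E 0 r s
E₀-even 0             s             _    = E₀-even-r<2 0 s (s≤s z≤n)
E₀-even 1             s             _    = E₀-even-r<2 1 s (s≤s (s≤s z≤n))
E₀-even (suc (suc r)) (suc (suc s)) near = E-shift 0 r s (E₀-even r s (ℕP.≤-pred near))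
E₀-even (suc (suc r)) 0             (s≤s ())
E₀-even (suc (suc r)) 1             (s≤s ())

E-even : ∀ m r s → ⌊ r /2⌋ < ⌊ s /2⌋ ℕ.+ 2 ℕ.^ m → 2^ 1 ∣ E m r s
E-even zero    r s near = E₀-even r s near
E-even (suc m) r s near = E-suc-∣ m term (2^∣-double (2^0∣ (E m r s)))
  where
  v = 2 ℕ.^ m
  term : ∀ k → 2^ 1 ∣ E m r k * E m k s
  term k with ⌊ r /2⌋ <? ⌊ k /2⌋ ℕ.+ v | ⌊ k /2⌋ <? ⌊ s /2⌋ ℕ.+ v
  ... | yes r~k | _       = 2^∣-*ʳ (E m k s) (E-even m r k r~k)
  ... | no _    | yes k~s = 2^∣-*ˡ (E m r k) (E-even m k s k~s)
  ... | no r≁k  | no k≁s  = contradiction near (ℕP.≤⇒≯ (begin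
    ⌊ s /2⌋ ℕ.+ 2 ℕ.^ suc m  ≡⟨ double (⌊ s /2⌋) v ⟩
    ⌊ s /2⌋ ℕ.+ v ℕ.+ v      ≤⟨ ℕP.+-monoˡ-≤ v (ℕP.≮⇒≥ k≁s) ⟩
    ⌊ k /2⌋ ℕ.+ v            ≤⟨ ℕP.≮⇒≥ r≁k ⟩
    ⌊ r /2⌋                  ∎))
    where
    open ℕP.≤-Reasoning
    double : ∀ h v → h ℕ.+ 2 ℕ.* v ≡ h ℕ.+ v ℕ.+ v
    double = NS.solve-∀

2*⌊n/2⌋≤n : ∀ n → 2 ℕ.* ⌊ n /2⌋ ≤ n
2*⌊n/2⌋≤n zero          = z≤n
2*⌊n/2⌋≤n (suc zero)    = z≤n
2*⌊n/2⌋≤n (suc (suc n)) = subst (_≤ suc (suc n)) (sym (ℕP.*-suc 2 ⌊ n /2⌋)) (s≤s (s≤s (2*⌊n/2⌋≤n n)))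

n≤1+2*⌊n/2⌋ : ∀ n → n ≤ suc (2 ℕ.* ⌊ n /2⌋)
n≤1+2*⌊n/2⌋ zero          = z≤n
n≤1+2*⌊n/2⌋ (suc zero)    = s≤s z≤n
n≤1+2*⌊n/2⌋ (suc (suc n)) = subst (suc (suc n) ≤_) (cong suc (sym (ℕP.*-suc 2 ⌊ n /2⌋))) (s≤s (s≤s (n≤1+2*⌊n/2⌋ n)))

E-even-near : ∀ m r s → suc r < s ℕ.+ 2 ℕ.^ suc m → 2^ 1 ∣ E m r s
E-even-near m r s 1+r<s+2v = E-even m r s (ℕP.*-cancelˡ-< 2 ⌊ r /2⌋ (⌊ s /2⌋ ℕ.+ v) (ℕP.≤-pred (begin
  suc (suc (2 ℕ.* ⌊ r /2⌋))            ≤⟨ s≤s (s≤s (2*⌊n/2⌋≤n r)) ⟩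
  suc (suc r)                          ≤⟨ 1+r<s+2v ⟩
  s ℕ.+ 2 ℕ.* v                        ≤⟨ ℕP.+-monoˡ-≤ (2 ℕ.* v) (n≤1+2*⌊n/2⌋ s) ⟩
  suc (2 ℕ.* ⌊ s /2⌋ ℕ.+ 2 ℕ.* v)      ≡⟨ cong suc (sym (ℕP.*-distribˡ-+ 2 ⌊ s /2⌋ v)) ⟩
  suc (2 ℕ.* (⌊ s /2⌋ ℕ.+ v))          ∎)))
  where
  open ℕP.≤-Reasoning
  v = 2 ℕ.^ m

E-even-low : ∀ m r s → r < 2 ℕ.^ suc m → 2^ 1 ∣ E m r s
E-even-low m r s r<2v = E-even m r s (ℕP.*-cancelˡ-< 2 ⌊ r /2⌋ (⌊ s /2⌋ ℕ.+ v) (begin-strict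
  2 ℕ.* ⌊ r /2⌋              ≤⟨ 2*⌊n/2⌋≤n r ⟩
  r                          <⟨ r<2v ⟩
  2 ℕ.* v                    ≤⟨ ℕP.*-monoʳ-≤ 2 (ℕP.m≤n+m v ⌊ s /2⌋) ⟩
  2 ℕ.* (⌊ s /2⌋ ℕ.+ v)      ∎))
  where
  open ℕP.≤-Reasoning
  v = 2 ℕ.^ m

-- Exact computation of the first rows of P^24 = P^(d 3)

-- A list xs stands for the finitely supported row whose i-th entry is xs[i], and 0 past its end.
at : List ℤ → ℕ → ℤ
at []       _       = + 0
at (x ∷ xs) zero    = x
at (x ∷ xs) (suc i) = at xs i

at-applyUpTo : ∀ (f : ℕ → ℤ) {n s} → s < n → at (applyUpTo f n) s ≡ f s
at-applyUpTo f {suc n} {zero}  _       = refl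
at-applyUpTo f {suc n} {suc s} 1+s<1+n = at-applyUpTo (f ∘ suc) (ℕP.≤-pred 1+s<1+n)

at-beyond : ∀ xs {i} → length xs ≤ i → at xs i ≡ + 0
at-beyond []       _            = refl
at-beyond (x ∷ xs) {suc i} 1+ℓ≤1+i = at-beyond xs (ℕP.≤-pred 1+ℓ≤1+i)

at-applyUpTo-beyond : ∀ (f : ℕ → ℤ) {n s} → n ≤ s → at (applyUpTo f n) s ≡ + 0
at-applyUpTo-beyond f {n} n≤s = at-beyond (applyUpTo f n) (subst (_≤ _) (sym (length-applyUpTo f n)) n≤s)

_·Pₗ : List ℤ → List ℤ
xs ·Pₗ = applyUpTo (row·P (at xs)) (suc (length xs))

at-·Pₗ : ∀ xs s → at (xs ·Pₗ) s ≡ row·P (at xs) s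
at-·Pₗ xs s with s <? suc (length xs)
... | yes s≤ℓ = at-applyUpTo (row·P (at xs)) s≤ℓ
at-·Pₗ xs zero    | no 0≰ℓ = ⊥-elim (0≰ℓ (s≤s z≤n))
at-·Pₗ xs (suc s) | no 1+s≰ℓ = trans (at-applyUpTo-beyond (row·P (at xs)) (ℕP.≮⇒≥ 1+s≰ℓ))
  (sym (row·P-vanish (at xs) s (at-beyond xs ℓ≤s) (at-beyond xs (ℕP.m≤n⇒m≤1+n ℓ≤s))
                               (at-beyond xs (ℕP.m≤n⇒m≤1+n (ℕP.m≤n⇒m≤1+n ℓ≤s)))))
  where
  ℓ≤s = ℕP.≤-pred (ℕP.≮⇒≥ 1+s≰ℓ)

rowP^ : ℕ → ℕ → List ℤ
rowP^ zero    r = applyUpTo (Id r) (suc r)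
rowP^ (suc n) r = rowP^ n r ·Pₗ

at-rowP^ : ∀ n r s → at (rowP^ n r) s ≡ P^ n r s
at-rowP^ zero r s with s <? suc r
... | yes s≤r = at-applyUpTo (Id r) s≤r
... | no s≰r  = trans (at-applyUpTo-beyond (Id r) (ℕP.≮⇒≥ s≰r))
                      (sym (Id-off (λ { refl → s≰r ℕP.≤-refl })))
at-rowP^ (suc n) r s = begin
  at (rowP^ n r ·Pₗ) s         ≡⟨ at-·Pₗ (rowP^ n r) s ⟩
  row·P (at (rowP^ n r)) s     ≡⟨ row·P-cong (at-rowP^ n r) s ⟩
  row·P (P^ n r) s             ≡⟨ P^-suc n r s ⟨
  P^ (suc n) r s               ∎
  where open ≡-Reasoning

RowBox : ℕ → ℕ → ℕ → ℕ → Set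
RowBox m k s₀ s₁ = ∀ {r} → r < 8 → ∀ {s} → s < s₁ → s₀ ≤ s → 2^ k ∣ at (rowP^ (d m) r) s - Id r s

rowBox? : ∀ m k s₀ s₁ → Dec (RowBox m k s₀ s₁)
rowBox? m k s₀ s₁ = allUpTo? (λ r → allUpTo? (λ s → s₀ ≤? s →-dec 2^? k ∣ (at (rowP^ (d m) r) s - Id r s)) s₁) 8

-- Explicit arguments: inferring them from E 3 r s would make Agda evaluate P^24 r s symbolically.
RowBox⇒∣E : ∀ m k s₀ s₁ → RowBox m k s₀ s₁ → ∀ r s → r < 8 → s₀ ≤ s → s < s₁ → 2^ k ∣ E m r s
RowBox⇒∣E m k s₀ s₁ box r s r<8 s₀≤s s<s₁ = subst (λ x → 2^ k ∣ x - Id r s) (at-rowP^ (d m) r s) (box r<8 s<s₁ s₀≤s)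

E₃-block₀ : ∀ r s → r < 8 → s < 8 → 2^ 2 ∣ E 3 r s
E₃-block₀ r s r<8 = RowBox⇒∣E 3 2 0 8 (from-yes (rowBox? 3 2 0 8)) r s r<8 z≤n

E₃-block₁ : ∀ r s → r < 8 → 8 ≤ s → s < 20 → 2^ 6 ∣ E 3 r s
E₃-block₁ = RowBox⇒∣E 3 6 8 20 (from-yes (rowBox? 3 6 8 20))

E₃-block₂ : ∀ r s → r < 8 → 20 ≤ s → s < 32 → 2^ 10 ∣ E 3 r s
E₃-block₂ = RowBox⇒∣E 3 10 20 32 (from-yes (rowBox? 3 10 20 32))

I-apart : ∀ j {a b r s} → 3 ℕ.+ a ≤ b → r ≤ 7 ℕ.+ d j ℕ.* a → 8 ℕ.+ d j ℕ.* b ≤ s → r ℕ.+ d (suc j) < s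
I-apart j {a} {b} {r} {s} 3+a≤b r≤7+wa 8+wb≤s = begin-strict
  r ℕ.+ d (suc j)               ≡⟨ cong (r ℕ.+_) (d-suc j) ⟩
  r ℕ.+ (w ℕ.+ w)               ≤⟨ ℕP.+-monoˡ-≤ (w ℕ.+ w) r≤7+wa ⟩
  7 ℕ.+ w ℕ.* a ℕ.+ (w ℕ.+ w)   ≡⟨ regroup w a ⟩
  7 ℕ.+ w ℕ.* (2 ℕ.+ a)         <⟨ ℕP.n<1+n _ ⟩
  8 ℕ.+ w ℕ.* (2 ℕ.+ a)         ≤⟨ ℕP.+-monoʳ-≤ 8 (ℕP.*-monoʳ-≤ w (ℕP.≤-trans (ℕP.n≤1+n (2 ℕ.+ a)) 3+a≤b)) ⟩
  8 ℕ.+ w ℕ.* b                 ≤⟨ 8+wb≤s ⟩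
  s                             ∎
  where
  open ℕP.≤-Reasoning
  w = d j
  regroup : ∀ w a → 7 ℕ.+ w ℕ.* a ℕ.+ (w ℕ.+ w) ≡ 7 ℕ.+ w ℕ.* (2 ℕ.+ a)
  regroup = NS.solve-∀

I-near : ∀ j {a b r s} → a ≤ b → r ≤ 7 ℕ.+ d j ℕ.* suc a → 8 ℕ.+ d j ℕ.* b ≤ s → suc r < s ℕ.+ 2 ℕ.^ suc (suc j)
I-near j {a} {b} {r} {s} a≤b r≤7+w[1+a] 8+wb≤s = begin
  2 ℕ.+ r                            ≤⟨ ℕP.+-monoʳ-≤ 2 r≤7+w[1+a] ⟩
  9 ℕ.+ 3 ℕ.* x ℕ.* suc a            ≤⟨ ℕP.+-monoʳ-≤ 9 (ℕP.*-monoʳ-≤ (3 ℕ.* x) (s≤s a≤b)) ⟩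
  9 ℕ.+ 3 ℕ.* x ℕ.* suc b            ≡⟨ regroup x b ⟩
  8 ℕ.+ 3 ℕ.* x ℕ.* b ℕ.+ (1 ℕ.+ 3 ℕ.* x)
                                     ≤⟨ ℕP.+-monoʳ-≤ (8 ℕ.+ 3 ℕ.* x ℕ.* b) (ℕP.+-monoˡ-≤ (3 ℕ.* x) (ℕP.m^n>0 2 j)) ⟩
  8 ℕ.+ 3 ℕ.* x ℕ.* b ℕ.+ (x ℕ.+ 3 ℕ.* x)
                                     ≡⟨ cong (8 ℕ.+ 3 ℕ.* x ℕ.* b ℕ.+_) (quadruple x) ⟩
  8 ℕ.+ 3 ℕ.* x ℕ.* b ℕ.+ 2 ℕ.^ suc (suc j)
                                     ≤⟨ ℕP.+-monoˡ-≤ (2 ℕ.^ suc (suc j)) 8+wb≤s ⟩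
  s ℕ.+ 2 ℕ.^ suc (suc j)            ∎
  where
  open ℕP.≤-Reasoning
  x = 2 ℕ.^ j
  regroup : ∀ x b → 9 ℕ.+ 3 ℕ.* x ℕ.* suc b ≡ 8 ℕ.+ 3 ℕ.* x ℕ.* b ℕ.+ (1 ℕ.+ 3 ℕ.* x)
  regroup = NS.solve-∀
  quadruple : ∀ x → x ℕ.+ 3 ℕ.* x ≡ 2 ℕ.* (2 ℕ.* x)
  quadruple = NS.solve-∀

I₁-low : ∀ j {r} → 3 ≤ j → r ≤ 7 ℕ.+ d j ℕ.* 1 → r < 2 ℕ.^ suc (suc j)
I₁-low j {r} 3≤j r≤7+w = begin-strict
  r                        ≤⟨ r≤7+w ⟩
  7 ℕ.+ 3 ℕ.* x ℕ.* 1      <⟨ ℕP.+-monoˡ-< (3 ℕ.* x ℕ.* 1) (ℕP.^-monoʳ-≤ 2 3≤j) ⟩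
  x ℕ.+ 3 ℕ.* x ℕ.* 1      ≡⟨ quadruple x ⟩
  2 ℕ.^ suc (suc j)        ∎
  where
  open ℕP.≤-Reasoning
  x = 2 ℕ.^ j
  quadruple : ∀ x → x ℕ.+ 3 ℕ.* x ℕ.* 1 ≡ 2 ℕ.* (2 ℕ.* x)
  quadruple = NS.solve-∀

I₁-near : ∀ j {k s} → k ≤ 7 ℕ.+ d j → 8 ≤ s → suc k < s ℕ.+ 2 ℕ.^ suc (suc j)
I₁-near j {k} {s} k≤7+w 8≤s =
  I-near j z≤n (subst (k ≤_) (cong (7 ℕ.+_) (sym (ℕP.*-identityʳ (d j)))) k≤7+w)
               (subst (_≤ s) (cong (8 ℕ.+_) (sym (ℕP.*-zeroʳ (d j)))) 8≤s)

I₁-far : ∀ j {k s} → 2 ≤ j → k ≤ 7 ℕ.+ d j → 8 ℕ.+ d (suc j) ≤ s → k ℕ.+ 10 ≤ s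
I₁-far j {k} {s} 2≤j k≤7+w 8+2w≤s = begin
  k ℕ.+ 10                     ≤⟨ ℕP.+-monoˡ-≤ 10 k≤7+w ⟩
  7 ℕ.+ 3 ℕ.* x ℕ.+ 10         ≡⟨ regroup x ⟩
  8 ℕ.+ (9 ℕ.+ 3 ℕ.* x)        ≤⟨ ℕP.+-monoʳ-≤ 8 (ℕP.+-monoˡ-≤ (3 ℕ.* x) (ℕP.*-monoʳ-≤ 3 3≤x)) ⟩
  8 ℕ.+ (3 ℕ.* x ℕ.+ 3 ℕ.* x)  ≡⟨ cong (8 ℕ.+_) (sym (d-suc j)) ⟩
  8 ℕ.+ d (suc j)              ≤⟨ 8+2w≤s ⟩
  s                            ∎
  where
  open ℕP.≤-Reasoning
  x = 2 ℕ.^ j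
  3≤x : 3 ≤ x
  3≤x = ℕP.≤-trans (ℕP.n≤1+n 3) (ℕP.^-monoʳ-≤ 2 2≤j)
  regroup : ∀ x → 7 ℕ.+ 3 ℕ.* x ℕ.+ 10 ≡ 8 ℕ.+ (9 ℕ.+ 3 ℕ.* x)
  regroup = NS.solve-∀

band-near : ∀ m {r k s} → r ≤ 7 → k ≤ r ℕ.+ d m → 8 ℕ.+ d m ≤ s → suc k < s ℕ.+ 2 ℕ.^ suc m
band-near m {r} {k} {s} r≤7 k≤r+d 8+d≤s = begin
  2 ℕ.+ k                      ≤⟨ ℕP.+-monoʳ-≤ 2 (ℕP.≤-trans k≤r+d (ℕP.+-monoˡ-≤ (d m) r≤7)) ⟩
  1 ℕ.+ (8 ℕ.+ d m)            ≤⟨ ℕP.+-monoˡ-≤ (8 ℕ.+ d m) (ℕP.m^n>0 2 (suc m)) ⟩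
  2 ℕ.^ suc m ℕ.+ (8 ℕ.+ d m)  ≤⟨ ℕP.+-monoʳ-≤ (2 ℕ.^ suc m) 8+d≤s ⟩
  2 ℕ.^ suc m ℕ.+ s            ≡⟨ ℕP.+-comm (2 ℕ.^ suc m) s ⟩
  s ℕ.+ 2 ℕ.^ suc m            ∎
  where open ℕP.≤-Reasoning

-- Rows in I₀; the three fields cover the columns in I₀, in I₁ and in I₂ ∪ I₃ ∪ ⋯.

record FirstRowBounds (m : ℕ) : Set where
  field
    block₀ : ∀ r s → r ≤ 7 → s ≤ 7 → 2^ (m ℕ.∸ 1) ∣ E m r s
    block₁ : ∀ r s → r ≤ 7 → 8 ≤ s → s ≤ 7 ℕ.+ d (m ℕ.∸ 1) → 2^ (m ℕ.+ 3) ∣ E m r s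
    beyond : ∀ r s → r ≤ 7 → 8 ℕ.+ d (m ℕ.∸ 1) ≤ s → 2^ (m ℕ.+ 7) ∣ E m r s

  outside-block₀ : ∀ r s → r ≤ 7 → 8 ≤ s → 2^ (m ℕ.+ 3) ∣ E m r s
  outside-block₀ r s r≤7 8≤s with s ≤? 7 ℕ.+ d (m ℕ.∸ 1)
  ... | yes s≤7+d = block₁ r s r≤7 8≤s s≤7+d
  ... | no  s≰7+d = 2^∣-weaken (ℕP.+-monoʳ-≤ m (s≤s (s≤s (s≤s z≤n)))) (beyond r s r≤7 (ℕP.≰⇒> s≰7+d))

firstRowBounds₃ : FirstRowBounds 3
firstRowBounds₃ = record
  { block₀ = λ r s r≤7 s≤7 → E₃-block₀ r s (s≤s r≤7) (s≤s s≤7)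
  ; block₁ = λ r s r≤7 8≤s s≤19 → E₃-block₁ r s (s≤s r≤7) 8≤s (s≤s s≤19)
  ; beyond = λ r s r≤7 20≤s → [ (λ s≤31 → E₃-block₂ r s (s≤s r≤7) 20≤s (s≤s s≤31))
                              , (λ 31<s → 2^∣-≡0 (E-above 3 r s (ℕP.≤-<-trans (ℕP.+-monoˡ-≤ 24 r≤7) 31<s)))
                              ]′ (ℕP.≤-<-connex s 31)
  }

module FirstRowStep (j : ℕ) (2≤j : 2 ≤ j) (bounds : FirstRowBounds (suc j)) where
  open FirstRowBounds bounds
  m = suc j

  1≤j : 1 ≤ j
  1≤j = ℕP.≤-trans (s≤s z≤n) 2≤j

  beyond-I₁ : ∀ {s} → 8 ℕ.+ d m ≤ s → 8 ℕ.+ d j ≤ s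
  beyond-I₁ = ℕP.≤-trans (ℕP.+-monoʳ-≤ 8 (subst (d j ≤_) (sym (d-suc j)) (ℕP.m≤m+n (d j) (d j))))

  block₀′ : ∀ r s → r ≤ 7 → s ≤ 7 → 2^ m ∣ E (suc m) r s
  block₀′ r s r≤7 s≤7 = E-suc-∣ m term (2^∣-double (block₀ r s r≤7 s≤7))
    where
    term : ∀ k → 2^ m ∣ E m r k * E m k s
    term k with k ≤? 7
    ... | yes k≤7 = 2^∣-weaken (ℕP.+-monoˡ-≤ j 1≤j) (2^∣-* (block₀ r k r≤7 k≤7) (block₀ k s k≤7 s≤7))
    ... | no  k≰7 = 2^∣-*ʳ (E m k s) (2^∣-weaken (ℕP.m≤m+n m 3) (outside-block₀ r k r≤7 (ℕP.≰⇒> k≰7)))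

  block₁′ : ∀ r s → r ≤ 7 → 8 ≤ s → s ≤ 7 ℕ.+ d m → 2^ (suc m ℕ.+ 3) ∣ E (suc m) r s
  block₁′ r s r≤7 8≤s _ = E-suc-∣ m term (2^∣-double (outside-block₀ r s r≤7 8≤s))
    where
    term : ∀ k → 2^ (suc m ℕ.+ 3) ∣ E m r k * E m k s
    term k with k ≤? 7 | k ≤? 7 ℕ.+ d j
    ... | yes k≤7 | _         = 2^∣-weaken (ℕP.+-monoˡ-≤ (m ℕ.+ 3) 1≤j)
                                  (2^∣-* (block₀ r k r≤7 k≤7) (outside-block₀ k s k≤7 8≤s))
    ... | no  k≰7 | yes k≤7+d = 2^∣-weaken (ℕP.≤-reflexive (ℕP.+-comm 1 (m ℕ.+ 3)))
                                  (2^∣-* (block₁ r k r≤7 (ℕP.≰⇒> k≰7) k≤7+d) (E-even-near m k s (I₁-near j k≤7+d 8≤s)))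
    ... | no  _   | no  k≰7+d = 2^∣-*ʳ (E m k s)
                                  (2^∣-weaken (ℕP.+-monoʳ-< m (s≤s (s≤s (s≤s (s≤s z≤n))))) (beyond r k r≤7 (ℕP.≰⇒> k≰7+d)))

  beyond′ : ∀ r s → r ≤ 7 → 8 ℕ.+ d m ≤ s → 2^ (suc m ℕ.+ 7) ∣ E (suc m) r s
  beyond′ r s r≤7 8+dm≤s = E-suc-∣ m term (2^∣-double (beyond r s r≤7 (beyond-I₁ 8+dm≤s)))
    where
    regroup : ∀ j → suc (suc j) ℕ.+ 7 ≡ suc j ℕ.+ 3 ℕ.+ 5
    regroup = NS.solve-∀
    term : ∀ k → 2^ (suc m ℕ.+ 7) ∣ E m r k * E m k s
    term k with k ≤? 7 | k ≤? 7 ℕ.+ d j | k ≤? r ℕ.+ d m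
    ... | yes k≤7 | _          | _          = 2^∣-weaken (ℕP.+-monoˡ-≤ (m ℕ.+ 7) 1≤j)
                                                (2^∣-* (block₀ r k r≤7 k≤7) (beyond k s k≤7 (beyond-I₁ 8+dm≤s)))
    ... | no  k≰7 | yes k≤7+dj | _          = 2^∣-weaken (ℕP.≤-reflexive (regroup j))
                                                (2^∣-* (block₁ r k r≤7 (ℕP.≰⇒> k≰7) k≤7+dj) (2^5∣E-far m k s (I₁-far j 2≤j k≤7+dj 8+dm≤s)))
    ... | no  _   | no  k≰7+dj | yes k≤r+dm = 2^∣-weaken (ℕP.≤-reflexive (ℕP.+-comm 1 (m ℕ.+ 7)))
                                                (2^∣-* (beyond r k r≤7 (ℕP.≰⇒> k≰7+dj)) (E-even-near m k s (band-near m r≤7 k≤r+dm 8+dm≤s)))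
    ... | no  _   | no  _      | no  k≰r+dm = 2^∣-≡0 (cong (_* E m k s) (E-above m r k (ℕP.≰⇒> k≰r+dm)))

firstRowBounds-suc : ∀ j → 2 ≤ j → FirstRowBounds (suc j) → FirstRowBounds (suc (suc j))
firstRowBounds-suc j 2≤j bounds = record { block₀ = block₀′ ; block₁ = block₁′ ; beyond = beyond′ }
  where open FirstRowStep j 2≤j bounds

firstRowBounds : ∀ t → FirstRowBounds (3 ℕ.+ t)
firstRowBounds zero    = firstRowBounds₃
firstRowBounds (suc t) = firstRowBounds-suc (2 ℕ.+ t) (s≤s (s≤s z≤n)) (firstRowBounds t)

data OffDiagonal (a b : ℕ) : ℕ∞ → Set where
  near-above : a ≤ b → OffDiagonal a b (fin 1)
  near-below : OffDiagonal a b (fin 0)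
  far-above  : 4 ℕ.+ a ≤ b → OffDiagonal a b ∞
  far-below  : 4 ℕ.+ b ≤ a → OffDiagonal a b ∞

apart : ∀ {a b} → a ≤ b → ¬ (b ∸ a ≤ 3) → 4 ℕ.+ a ≤ b
apart {a} a≤b gap = ℕP.≤-trans (ℕP.+-monoˡ-≤ a (ℕP.≰⇒> gap)) (ℕP.≤-reflexive (ℕP.m∸n+n≡m a≤b))

offDiagonal : ∀ m a b → OffDiagonal a b (M m (suc a) (suc b))
offDiagonal m 0 b with b ≤? 3
... | yes _   = near-above z≤n
... | no  gap = far-above (apart z≤n gap)
offDiagonal m 1 b with 1 ≤? b
... | yes a≤b with b ∸ 1 ≤? 3
...   | yes _   = near-above a≤b
...   | no  gap = far-above (apart a≤b gap)
offDiagonal m 1 b | no a≰b with 1 ∸ b ≤? 3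
...   | yes _   = near-below
...   | no  gap = far-below (apart (ℕP.≰⇒≥ a≰b) gap)
offDiagonal m 2 b with 2 ≤? b
... | yes a≤b with b ∸ 2 ≤? 3
...   | yes _   = near-above a≤b
...   | no  gap = far-above (apart a≤b gap)
offDiagonal m 2 b | no a≰b with 2 ∸ b ≤? 3
...   | yes _   = near-below
...   | no  gap = far-below (apart (ℕP.≰⇒≥ a≰b) gap)
offDiagonal m (suc (suc (suc a))) b with suc (suc (suc a)) ≤? b
... | yes a≤b with b ∸ suc (suc (suc a)) ≤? 3
...   | yes _   = near-above a≤b
...   | no  gap = far-above (apart a≤b gap)
offDiagonal m (suc (suc (suc a))) b | no a≰b with suc (suc (suc a)) ∸ b ≤? 3
...   | yes _   = near-below
...   | no  gap = far-below (apart (ℕP.≰⇒≥ a≰b) gap)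

proposition5p6 : (m : ℕ) → 4 ≤ m → (a b r s : ℕ) →
    InI m a r → InI m b s → M m a b ≤ν₂ E m r s
proposition5p6 m@(suc (suc (suc (suc t)))) (s≤s (s≤s (s≤s (s≤s z≤n)))) = bound
  where
  open FirstRowBounds (firstRowBounds (suc t))
  j = 3 ℕ.+ t
  w = d j
  bound : (a b r s : ℕ) → InI m a r → InI m b s → M m a b ≤ν₂ E m r s
  bound 0 0 r s r≤7 s≤7 = ∣⇒≤ν₂ (block₀ r s r≤7 s≤7)
  bound 0 1 r s r≤7 (lo , hi) = ∣⇒≤ν₂ (block₁ r s r≤7 (subst (_≤ s) (cong (8 ℕ.+_) (ℕP.*-zeroʳ w)) lo)
                                                       (subst (s ≤_) (cong (7 ℕ.+_) (ℕP.*-identityʳ w)) hi))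
  bound 0 2 r s r≤7 (lo , _) = ∣⇒≤ν₂ (beyond r s r≤7 (subst (_≤ s) (cong (8 ℕ.+_) (ℕP.*-identityʳ w)) lo))
  bound 0 3 r s r≤7 (lo , _) = ∣⇒≤ν₂ (beyond r s r≤7 (ℕP.≤-trans (ℕP.+-monoʳ-≤ 8 (ℕP.m≤m*n w 2)) lo))
  bound 0 (suc (suc (suc (suc b)))) r s r≤7 (lo , _) =
    E-above m r s (I-apart j (ℕP.m≤m+n 3 b) (ℕP.≤-trans r≤7 (ℕP.m≤m+n 7 (w ℕ.* 0))) lo)
  bound 1 0 r s (_ , hi) _ = ∣⇒≤ν₂ (E-even-low m r s (I₁-low j (ℕP.m≤m+n 3 t) hi))
  bound 2 0 r s _ _ = ∣⇒≤ν₂ (2^0∣ (E m r s))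
  bound 3 0 r s _ _ = ∣⇒≤ν₂ (2^0∣ (E m r s))
  bound (suc (suc (suc (suc a)))) 0 r s (lo , _) s≤7 =
    E-below m r s (I-apart j (ℕP.m≤m+n 3 a) (ℕP.≤-trans s≤7 (ℕP.m≤m+n 7 (w ℕ.* 0))) lo)
  bound (suc a) (suc b) r s (lo₁ , hi₁) (lo₂ , hi₂) with M m (suc a) (suc b) | offDiagonal m a b
  ... | _ | near-above a≤b  = ∣⇒≤ν₂ (E-even-near m r s (I-near j a≤b hi₁ lo₂))
  ... | _ | near-below      = ∣⇒≤ν₂ (2^0∣ (E m r s))
  ... | _ | far-above 4+a≤b = E-above m r s (I-apart j 4+a≤b hi₁ lo₂)
  ... | _ | far-below 4+b≤a = E-below m r s (I-apart j 4+b≤a hi₂ lo₁)
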